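{- Let $c_1,\ldots,c_n$ be positive integers and, for $1\le i\le j\le n$, set $K^q_{i,j}:=K_{j-i-1}(c_{i+1},\ldots,c_{j-1})_q$, with the conventions $K^q_{i,i}=0$ and $K^q_{i,i+1}=1$. Then for all $1\le i<j<k<\ell\le n$, $$K^q_{i,k}K^q_{j,\ell}=q^{c_j+\cdots+c_{k-1}-(k-j)}\,K^q_{i,j}K^q_{k,\ell}+K^q_{j,k}K^q_{i,\ell}.$$
   Context: $q$ is a formal variable and $[a]_q=1+q+\cdots+q^{a-1}$. For positive integers $d_1,\ldots,d_p$, the $q$-continuant $K_p(d_1,\ldots,d_p)_q$ is the determinant of the $p\times p$ tridiagonal matrix with diagonal entries $[d_1]_q,\ldots,[d_p]_q$, entry $q^{d_t-1}$ in position $(t,t+1)$ for $1\le t\le p-1$, entry $1$ in position $(t+1,t)$, and zeros elsewhere. -}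

module Defs where

open import Level using (Level)
open import Algebra.Bundles using (CommutativeRing)
open import Data.Nat as ℕ using (ℕ; zero; suc; _∸_; _≤?_)
open import Data.List using (List; []; _∷_; map; upTo)
open import Data.Nat.ListAction using (sum)
open import Relation.Nullary using (yes; no)

-- We work in an arbitrary commutative ring R with a distinguished element q.
-- An identity holding for every such (R , q) is exactly an identity in ℤ[q]
-- (take R = ℤ[q], q the formal variable).
module Continuant {c ℓ : Level} (R : CommutativeRing c ℓ) (q : CommutativeRing.Carrier R) where
  open CommutativeRing R

  qpow : ℕ → Carrier
  qpow zero    = 1#
  qpow (suc m) = q * qpow m

  qint : ℕ → Carrier
  qint zero    = 0#
  qint (suc a) = qpow a + qint a

  -- K_p(d_1,...,d_p)_q : determinant of the p×p tridiagonal matrix with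
  -- diagonal [d_t]_q, superdiagonal q^(d_t - 1), subdiagonal 1.
  -- Computed by Laplace expansion along the first row:
  --   K() = 1,  K(d) = [d]_q,
  --   K(d₁,d₂,…) = [d₁]_q K(d₂,…) - q^(d₁-1) · 1 · K(d₃,…).
  K : List ℕ → Carrier
  K []                 = 1#
  K (d ∷ [])           = qint d
  K (d₁ ∷ d₂ ∷ ds)     = qint d₁ * K (d₂ ∷ ds) - qpow (d₁ ∸ 1) * K ds

  -- The sequence c is given as a function ℕ → ℕ, indexed from 1.
  Kq : (ℕ → ℕ) → ℕ → ℕ → Carrier
  Kq cs i j with j ≤? i
  ... | yes _ = 0#
  ... | no  _ = K (map (λ t → cs (suc (i ℕ.+ t))) (upTo (j ∸ i ∸ 1)))

segSum : (ℕ → ℕ) → ℕ → ℕ → ℕ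
segSum cs j k = sum (map (λ t → cs (j ℕ.+ t)) (upTo (k ∸ j)))

{-# OPTIONS --safe #-}
module Submission where

-- With U, V, W the
-- windows strictly between i < j < k < l, x = c_j and y = c_k, the identity reads
--   K(U x V) K(V y W) = q^e K(U) K(W) + K(V) K(U x V y W),   e = Σ_{d ∈ x V} (d - 1).
-- It is linear in the triple (K(U x V), K(U), K(U x V y W)), and expanding K along the
-- first entry of d ∷ U expresses the triple for d ∷ U as [d]_q times the triple for U
-- minus q^(d-1) times the triple for U with its head removed.  When U = [] the latter is
-- replaced by (K(V), 0, K(V y W)), for which the identity is trivial, so it propagates
-- from U = [] by induction on U.  For U = [] it is the Casoratian identity
--   K(x V) K(V y W) - K(V) K(x V y W) = q^e K(W),
-- proved by the same expansion and induction on V.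

open import Level using (Level)
open import Algebra.Bundles using (CommutativeRing; RawRing)
open import Algebra.Solver.Ring.AlmostCommutativeRing
  using (_-Raw-AlmostCommutative⟶_; fromCommutativeRing)
open import Data.Maybe using (Maybe; just; nothing)
open import Data.Nat as ℕ using (ℕ; zero; suc; _∸_; _≤_; _<_)
import Data.Nat.Properties as ℕ
open import Data.List using (List; []; _∷_; _++_; map; length; applyUpTo; upTo)
open import Data.List.Properties using (map-upTo; length-applyUpTo)
open import Data.List.Relation.Unary.All using (All; []; _∷_)
open import Data.List.Relation.Unary.All.Properties using (applyUpTo⁺₁)
open import Data.Empty using (⊥-elim)
open import Data.Nat.ListAction using (sum)
open import Data.Product using (_×_; _,_)
open import Relation.Nullary using (yes; no)
open import Relation.Binary.PropositionalEquality as ≡ using (_≡_)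
open import Data.Nat.Tactic.RingSolver using (solve-∀)

open import Defs

-- ℤ presented as formal differences m − n: the map into R is then easily
-- a homomorphism, and equality of coefficients is decidable.
ℤ-differences : RawRing Level.zero Level.zero
ℤ-differences = record
  { Carrier = ℕ × ℕ
  ; _≈_     = _≡_
  ; _+_     = λ { (a , b) (c , d) → (a ℕ.+ c , b ℕ.+ d) }
  ; _*_     = λ { (a , b) (c , d) → (a ℕ.* c ℕ.+ b ℕ.* d , a ℕ.* d ℕ.+ b ℕ.* c) }
  ; -_      = λ { (a , b) → (b , a) }
  ; 0#      = (0 , 0)
  ; 1#      = (1 , 0)
  }

module IntegerCoefficients {r ℓ : Level} (R : CommutativeRing r ℓ) where
  open CommutativeRing R
  open import Algebra.Properties.Ring ring using (-0#≈0#; -‿+-comm; [y-z]x≈yx-zx; x[y-z]≈xy-xz)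
  open import Algebra.Properties.AbelianGroup +-abelianGroup using (⁻¹-anti-homo‿-)
  open import Algebra.Properties.CommutativeSemigroup +-commutativeSemigroup using (interchange)
  open import Algebra.Properties.Semiring.Mult semiring renaming (_×_ to _·_) using (×-homo-+; ×1-homo-*)
  open import Relation.Binary.Reasoning.Setoid setoid

  private
    fromDifference : ℕ × ℕ → Carrier
    fromDifference (m , n) = m · 1# - n · 1#

    -‿+-distrib : ∀ x y z w → (x - y) + (z - w) ≈ (x + z) - (y + w)
    -‿+-distrib x y z w = trans (interchange x (- y) z (- w)) (+-congˡ (-‿+-comm y w))

    -‿*-distrib : ∀ x y z w → (x - y) * (z - w) ≈ (x * z + y * w) - (x * w + y * z)
    -‿*-distrib x y z w = begin
      (x - y) * (z - w)
        ≈⟨ [y-z]x≈yx-zx (z - w) x y ⟩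
      x * (z - w) - y * (z - w)
        ≈⟨ +-cong (x[y-z]≈xy-xz x z w) (trans (-‿cong (x[y-z]≈xy-xz y z w)) (⁻¹-anti-homo‿- _ _)) ⟩
      (x * z - x * w) + (y * w - y * z)
        ≈⟨ -‿+-distrib _ _ _ _ ⟩
      (x * z + y * w) - (x * w + y * z)  ∎

    -‿cancelʳ : ∀ x y w → (x + w) - (y + w) ≈ x - y
    -‿cancelʳ x y w = begin
      (x + w) - (y + w)  ≈⟨ -‿+-distrib x y w w ⟨
      (x - y) + (w - w)  ≈⟨ +-congˡ (-‿inverseʳ w) ⟩
      (x - y) + 0#       ≈⟨ +-identityʳ _ ⟩
      x - y              ∎

    homomorphism : ℤ-differences -Raw-AlmostCommutative⟶ fromCommutativeRing R
    homomorphism = record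
      { ⟦_⟧    = fromDifference
      ; +-homo = λ { (a , b) (c , d) →
          trans (+-cong (×-homo-+ 1# a c) (-‿cong (×-homo-+ 1# b d))) (sym (-‿+-distrib _ _ _ _)) }
      ; *-homo = λ { (a , b) (c , d) →
          trans (+-cong (trans (×-homo-+ 1# (a ℕ.* c) (b ℕ.* d))
                               (+-cong (×1-homo-* a c) (×1-homo-* b d)))
                        (-‿cong (trans (×-homo-+ 1# (a ℕ.* d) (b ℕ.* c))
                                       (+-cong (×1-homo-* a d) (×1-homo-* b c)))))
                (sym (-‿*-distrib _ _ _ _)) }
      ; -‿homo = λ { (a , b) → sym (⁻¹-anti-homo‿- _ _) }
      ; 0-homo = -‿inverseʳ 0#
      ; 1-homo = trans (+-cong (+-identityʳ 1#) -0#≈0#) (+-identityʳ 1#)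
      }

    fromDifference-cong : ∀ a b c d → a ℕ.+ d ≡ c ℕ.+ b →
      fromDifference (a , b) ≈ fromDifference (c , d)
    fromDifference-cong a b c d eq = begin
      a · 1# - b · 1#
        ≈⟨ -‿cancelʳ _ _ (d · 1#) ⟨
      (a · 1# + d · 1#) - (b · 1# + d · 1#)
        ≈⟨ +-cong (trans (sym (×-homo-+ 1# a d)) (reflexive (≡.cong (_· 1#) eq))) (-‿cong (+-comm _ _)) ⟩
      (c ℕ.+ b) · 1# - (d · 1# + b · 1#)
        ≈⟨ +-congʳ (×-homo-+ 1# c b) ⟩
      (c · 1# + b · 1#) - (d · 1# + b · 1#)
        ≈⟨ -‿cancelʳ _ _ (b · 1#) ⟩
      c · 1# - d · 1#  ∎

    fromDifference-≟ : ∀ x y → Maybe (fromDifference x ≈ fromDifference y)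
    fromDifference-≟ (a , b) (c , d) with a ℕ.+ d ℕ.≟ c ℕ.+ b
    ... | yes eq = just (fromDifference-cong a b c d eq)
    ... | no _   = nothing

  open import Algebra.Solver.Ring ℤ-differences (fromCommutativeRing R) homomorphism fromDifference-≟
    public

excess : List ℕ → ℕ
excess ds = sum (map (_∸ 1) ds)

excess+length : ∀ {ds} → All (1 ≤_) ds → excess ds ℕ.+ length ds ≡ sum ds
excess+length []                    = ≡.refl
excess+length {d ∷ ds} (1≤d ∷ 1≤ds) = begin
  (d ∸ 1 ℕ.+ excess ds) ℕ.+ suc (length ds)  ≡⟨ ℕ.+-suc _ (length ds) ⟩
  suc (d ∸ 1 ℕ.+ excess ds ℕ.+ length ds)    ≡⟨ ≡.cong suc (ℕ.+-assoc (d ∸ 1) _ _) ⟩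
  suc (d ∸ 1) ℕ.+ (excess ds ℕ.+ length ds)  ≡⟨ ≡.cong₂ ℕ._+_ (ℕ.m+[n∸m]≡n 1≤d)
                                                              (excess+length 1≤ds) ⟩
  d ℕ.+ sum ds                               ∎
  where open ≡.≡-Reasoning

module ContinuantIdentities {r ℓ : Level} (R : CommutativeRing r ℓ) (q : CommutativeRing.Carrier R) where
  open CommutativeRing R
  open Continuant R q
  open IntegerCoefficients R using (solve; _:=_; _:+_; _:*_; _:-_)
  open import Algebra.Properties.Ring ring using (-0#≈0#)
  open import Relation.Binary.Reasoning.Setoid setoid

  qpow-+ : ∀ m n → qpow (m ℕ.+ n) ≈ qpow m * qpow n
  qpow-+ zero    n = sym (*-identityˡ (qpow n))
  qpow-+ (suc m) n = trans (*-congˡ (qpow-+ m n)) (sym (*-assoc q _ _))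

  combine-relations : ∀ {Q Y Z W u₁ v₁ w₁ u₂ v₂ w₂} a b →
    u₁ * Y ≈ Q * (v₁ * Z) + W * w₁ → u₂ * Y ≈ Q * (v₂ * Z) + W * w₂ →
    (a * u₁ - b * u₂) * Y ≈ Q * ((a * v₁ - b * v₂) * Z) + W * (a * w₁ - b * w₂)
  combine-relations {Q} {Y} {Z} {W} {u₁} {v₁} {w₁} {u₂} {v₂} {w₂} a b rel₁ rel₂ = begin
    (a * u₁ - b * u₂) * Y
      ≈⟨ solve 5 (λ a b u₁ u₂ Y → (a :* u₁ :- b :* u₂) :* Y := a :* (u₁ :* Y) :- b :* (u₂ :* Y))
           refl a b u₁ u₂ Y ⟩
    a * (u₁ * Y) - b * (u₂ * Y)
      ≈⟨ +-cong (*-congˡ rel₁) (-‿cong (*-congˡ rel₂)) ⟩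
    a * (Q * (v₁ * Z) + W * w₁) - b * (Q * (v₂ * Z) + W * w₂)
      ≈⟨ solve 9 (λ a b Q Z W v₁ w₁ v₂ w₂ →
             a :* (Q :* (v₁ :* Z) :+ W :* w₁) :- b :* (Q :* (v₂ :* Z) :+ W :* w₂)
               := Q :* ((a :* v₁ :- b :* v₂) :* Z) :+ W :* (a :* w₁ :- b :* w₂))
           refl a b Q Z W v₁ w₁ v₂ w₂ ⟩
    Q * ((a * v₁ - b * v₂) * Z) + W * (a * w₁ - b * w₂)  ∎

  K-casoratian : ∀ x v y w →
    K (x ∷ v) * K (v ++ y ∷ w) - K v * K (x ∷ v ++ y ∷ w) ≈ qpow (excess (x ∷ v)) * K w
  K-casoratian x [] y w = begin
    qint x * K (y ∷ w) - 1# * (qint x * K (y ∷ w) - qpow (x ∸ 1) * K w)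
      ≈⟨ +-congˡ (-‿cong (*-identityˡ _)) ⟩
    qint x * K (y ∷ w) - (qint x * K (y ∷ w) - qpow (x ∸ 1) * K w)
      ≈⟨ solve 4 (λ a Y b Z → a :* Y :- (a :* Y :- b :* Z) := b :* Z)
           refl (qint x) (K (y ∷ w)) (qpow (x ∸ 1)) (K w) ⟩
    qpow (x ∸ 1) * K w
      ≈⟨ *-congʳ (reflexive (≡.cong qpow (≡.sym (ℕ.+-identityʳ (x ∸ 1))))) ⟩
    qpow (x ∸ 1 ℕ.+ 0) * K w  ∎
  K-casoratian x (v₁ ∷ v) y w = begin
    (a * A - b * B) * C - A * (a * C - b * D)
      ≈⟨ solve 6 (λ a b A B C D →
             (a :* A :- b :* B) :* C :- A :* (a :* C :- b :* D) := b :* (A :* D :- B :* C))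
           refl a b A B C D ⟩
    b * (A * D - B * C)                           ≈⟨ *-congˡ (K-casoratian v₁ v y w) ⟩
    b * (qpow (excess (v₁ ∷ v)) * K w)            ≈⟨ *-assoc _ _ _ ⟨
    b * qpow (excess (v₁ ∷ v)) * K w              ≈⟨ *-congʳ (qpow-+ (x ∸ 1) _) ⟨
    qpow (excess (x ∷ v₁ ∷ v)) * K w              ∎
    where
    a = qint x
    b = qpow (x ∸ 1)
    A = K (v₁ ∷ v)
    B = K v
    C = K (v₁ ∷ v ++ y ∷ w)
    D = K (v ++ y ∷ w)

  K-ptolemy : ∀ u x v y w →
    K (u ++ x ∷ v) * K (v ++ y ∷ w) ≈ qpow (excess (x ∷ v)) * (K u * K w) + K v * K (u ++ x ∷ v ++ y ∷ w)
  K-ptolemy [] x v y w = begin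
    X                 ≈⟨ solve 2 (λ X Z → X := (X :- Z) :+ Z) refl X Z ⟩
    (X - Z) + Z       ≈⟨ +-congʳ (K-casoratian x v y w) ⟩
    Q * K w + Z       ≈⟨ +-congʳ (*-congˡ (*-identityˡ (K w))) ⟨
    Q * (1# * K w) + Z ∎
    where
    X = K (x ∷ v) * K (v ++ y ∷ w)
    Z = K v * K (x ∷ v ++ y ∷ w)
    Q = qpow (excess (x ∷ v))
  K-ptolemy (d ∷ []) x v y w = begin
    K (d ∷ x ∷ v) * K (v ++ y ∷ w)
      ≈⟨ combine-relations (qint d) (qpow (d ∸ 1)) (K-ptolemy [] x v y w) degenerate ⟩
    Q * ((qint d * 1# - qpow (d ∸ 1) * 0#) * K w) + K v * K (d ∷ x ∷ v ++ y ∷ w)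
      ≈⟨ +-congʳ (*-congˡ (*-congʳ K-expand-singleton)) ⟩
    Q * (qint d * K w) + K v * K (d ∷ x ∷ v ++ y ∷ w)  ∎
    where
    Q = qpow (excess (x ∷ v))
    K-expand-singleton : qint d * K [] - qpow (d ∸ 1) * 0# ≈ K (d ∷ [])
    K-expand-singleton = trans (+-cong (*-identityʳ _) (trans (-‿cong (zeroʳ _)) -0#≈0#)) (+-identityʳ _)
    degenerate : K v * K (v ++ y ∷ w) ≈ Q * (0# * K w) + K v * K (v ++ y ∷ w)
    degenerate = sym (trans (+-congʳ (trans (*-congˡ (zeroˡ (K w))) (zeroʳ Q))) (+-identityˡ _))
  K-ptolemy (d₁ ∷ d₂ ∷ u) x v y w =
    combine-relations (qint d₁) (qpow (d₁ ∸ 1)) (K-ptolemy (d₂ ∷ u) x v y w) (K-ptolemy u x v y w)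

module Windows (c : ℕ → ℕ) where
  open ≡.≡-Reasoning

  window : ℕ → ℕ → List ℕ
  window s zero    = []
  window s (suc n) = c s ∷ window (suc s) n

  applyUpTo-window : ∀ s n → applyUpTo (λ t → c (s ℕ.+ t)) n ≡ window s n
  applyUpTo-window s n = go s n (λ _ → ≡.refl)
    where
    go : ∀ {f} s n → (∀ t → f t ≡ c (s ℕ.+ t)) → applyUpTo f n ≡ window s n
    go s zero    f≗ = ≡.refl
    go s (suc n) f≗ = ≡.cong₂ _∷_ (≡.trans (f≗ 0) (≡.cong c (ℕ.+-identityʳ s)))
                                 (go (suc s) n (λ t → ≡.trans (f≗ (suc t)) (≡.cong c (ℕ.+-suc s t))))

  window-++ : ∀ s m n → window s (m ℕ.+ n) ≡ window s m ++ window (s ℕ.+ m) n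
  window-++ s zero    n = ≡.cong (λ s′ → window s′ n) (≡.sym (ℕ.+-identityʳ s))
  window-++ s (suc m) n = ≡.cong (c s ∷_) (≡.trans (window-++ (suc s) m n)
    (≡.cong (λ s′ → window (suc s) m ++ window s′ n) (≡.sym (ℕ.+-suc s m))))

  segSum∸gap : ∀ j k → (∀ {t} → t < k ∸ j → 1 ≤ c (j ℕ.+ t)) →
    segSum c j k ∸ (k ∸ j) ≡ excess (window j (k ∸ j))
  segSum∸gap j k = go (k ∸ j)
    where
    go : ∀ n → (∀ {t} → t < n → 1 ≤ c (j ℕ.+ t)) →
      sum (map (λ t → c (j ℕ.+ t)) (upTo n)) ∸ n ≡ excess (window j n)
    go n positive = begin
      sum (map (λ t → c (j ℕ.+ t)) (upTo n)) ∸ n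
        ≡⟨ ≡.cong₂ _∸_ (≡.cong sum (≡.trans (map-upTo _ n) (applyUpTo-window j n)))
                       (≡.sym length-window) ⟩
      sum (window j n) ∸ length (window j n)
        ≡⟨ ≡.cong (_∸ length (window j n)) (excess+length all-positive) ⟨
      excess (window j n) ℕ.+ length (window j n) ∸ length (window j n)
        ≡⟨ ℕ.m+n∸n≡m _ (length (window j n)) ⟩
      excess (window j n)  ∎
      where
      length-window : length (window j n) ≡ n
      length-window = ≡.trans (≡.cong length (≡.sym (applyUpTo-window j n))) (length-applyUpTo _ n)
      all-positive : All (1 ≤_) (window j n)
      all-positive = ≡.subst (All (1 ≤_)) (applyUpTo-window j n) (applyUpTo⁺₁ _ n positive)

module _ {a ℓ : Level} (R : CommutativeRing a ℓ) (q : CommutativeRing.Carrier R) (c : ℕ → ℕ) where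
  open CommutativeRing R
  open Continuant R q
  open ContinuantIdentities R q
  open Windows c
  open import Relation.Binary.Reasoning.Setoid setoid

  Kq-window : ∀ {i x} n → suc i ℕ.+ n ≡ x → Kq c i x ≡ K (window (suc i) n)
  Kq-window {i} n ≡.refl with suc (i ℕ.+ n) ℕ.≤? i
  ... | yes i+n<i = ⊥-elim (ℕ.m+n≮m i n i+n<i)
  ... | no _      = ≡.cong K (≡.trans (map-upTo _ (suc (i ℕ.+ n) ∸ i ∸ 1))
                                      (≡.trans (≡.cong (applyUpTo _) gap) (applyUpTo-window (suc i) n)))
    where
    gap : suc (i ℕ.+ n) ∸ i ∸ 1 ≡ n
    gap = ≡.cong (_∸ 1) (≡.trans (≡.cong (_∸ i) (≡.sym (ℕ.+-suc i n))) (ℕ.m+n∸m≡n i (suc n)))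

  Kq-split : ∀ {x} i a b → suc (suc i ℕ.+ a) ℕ.+ b ≡ x →
    Kq c i x ≡ K (window (suc i) a ++ c (suc i ℕ.+ a) ∷ window (suc (suc i ℕ.+ a)) b)
  Kq-split i a b eq =
    ≡.trans (Kq-window (a ℕ.+ suc b) (≡.trans (offsets i a b) eq)) (≡.cong K (window-++ (suc i) a (suc b)))
    where
    offsets : ∀ i a b → suc i ℕ.+ (a ℕ.+ suc b) ≡ suc (suc i ℕ.+ a) ℕ.+ b
    offsets = solve-∀

  Kq-ptolemy : ∀ {i j k l} → i < j → j < k → k < l →
    Kq c i k * Kq c j l ≈ qpow (excess (window j (k ∸ j))) * (Kq c i j * Kq c k l) + Kq c j k * Kq c i l
  Kq-ptolemy {i} i<j j<k k<l
    with ℕ.m≤n⇒∃[o]m+o≡n i<j | ℕ.m≤n⇒∃[o]m+o≡n j<k | ℕ.m≤n⇒∃[o]m+o≡n k<l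
  ... | a , ≡.refl | b , ≡.refl | e , ≡.refl = begin
    Kq c i k * Kq c j l
      ≡⟨ ≡.cong₂ _*_ (Kq-split i a b ≡.refl) (Kq-split j b e ≡.refl) ⟩
    K (U ++ c j ∷ V) * K (V ++ c k ∷ W)
      ≈⟨ K-ptolemy U (c j) V (c k) W ⟩
    qpow (excess (c j ∷ V)) * (K U * K W) + K V * K (U ++ c j ∷ V ++ c k ∷ W)
      ≡⟨ ≡.cong₂ _+_ (≡.cong₂ _*_ (≡.cong (λ g → qpow (excess (window j g))) gap)
                                  (≡.cong₂ _*_ (Kq-window a ≡.refl) (Kq-window e ≡.refl)))
                     (≡.cong₂ _*_ (Kq-window b ≡.refl) Kq-il) ⟨
    qpow (excess (window j (k ∸ j))) * (Kq c i j * Kq c k l) + Kq c j k * Kq c i l  ∎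
    where
    j = suc i ℕ.+ a
    k = suc j ℕ.+ b
    l = suc k ℕ.+ e
    U = window (suc i) a
    V = window (suc j) b
    W = window (suc k) e
    gap : k ∸ j ≡ suc b
    gap = ≡.trans (≡.cong (_∸ j) (≡.sym (ℕ.+-suc j b))) (ℕ.m+n∸m≡n j (suc b))
    Kq-il : Kq c i l ≡ K (U ++ c j ∷ V ++ c k ∷ W)
    Kq-il = ≡.trans (Kq-split i a (b ℕ.+ suc e) (offsets i a b e))
                    (≡.cong (λ r → K (U ++ c j ∷ r)) (window-++ (suc j) b (suc e)))
      where
      offsets : ∀ i a b e → suc (suc i ℕ.+ a) ℕ.+ (b ℕ.+ suc e) ≡ suc (suc (suc i ℕ.+ a) ℕ.+ b) ℕ.+ e
      offsets = solve-∀

proposition5p5 : {a ℓ : Level} (R : CommutativeRing a ℓ) (q : CommutativeRing.Carrier R)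
    (n : ℕ) (c : ℕ → ℕ) → (∀ t → 1 ≤ t → t ≤ n → 1 ≤ c t) →
    (i j k l : ℕ) → 1 ≤ i → i < j → j < k → k < l → l ≤ n →
    let open CommutativeRing R
        open Continuant R q
    in Kq c i k * Kq c j l
       ≈ qpow (segSum c j k ∸ (k ∸ j)) * (Kq c i j * Kq c k l) + Kq c j k * Kq c i l
proposition5p5 R q n c c-positive i j k l 1≤i i<j j<k k<l l≤n = begin
  Kq c i k * Kq c j l
    ≈⟨ Kq-ptolemy R q c i<j j<k k<l ⟩
  qpow (excess (window j (k ∸ j))) * (Kq c i j * Kq c k l) + Kq c j k * Kq c i l
    ≡⟨ ≡.cong (λ e → qpow e * (Kq c i j * Kq c k l) + Kq c j k * Kq c i l)
              (segSum∸gap j k window-positive) ⟨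
  qpow (segSum c j k ∸ (k ∸ j)) * (Kq c i j * Kq c k l) + Kq c j k * Kq c i l  ∎
  where
  open CommutativeRing R
  open Continuant R q
  open Windows c
  open import Relation.Binary.Reasoning.Setoid setoid
  window-positive : ∀ {t} → t < k ∸ j → 1 ≤ c (j ℕ.+ t)
  window-positive {t} t<k∸j = c-positive (j ℕ.+ t)
    (ℕ.≤-trans 1≤i (ℕ.≤-trans (ℕ.<⇒≤ i<j) (ℕ.m≤m+n j t)))
    (ℕ.<⇒≤ (ℕ.<-≤-trans j+t<k (ℕ.≤-trans (ℕ.<⇒≤ k<l) l≤n)))
    where
    j+t<k : j ℕ.+ t < k
    j+t<k = ℕ.<-≤-trans (ℕ.+-monoʳ-< j t<k∸j) (ℕ.≤-reflexive (ℕ.m+[n∸m]≡n (ℕ.<⇒≤ j<k)))
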